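{- Let $C$ be a set and $F,G$ Plott functions on $C$. Let $(Y,Z)$ be a semi-stable pair, and define $Y'=Y\cup F(Z)$ and $Z'=(Z\setminus F(Z))\cup G(F(Z))$. Then $(Y',Z')$ is a semi-stable pair.
   Context: A choice function on a set $C$ is a map $G:2^C\to 2^C$ with $G(X)\subseteq X$ for all $X\subseteq C$; it is a Plott function if $G(X\cup Y)=G(G(X)\cup Y)$ for all $X,Y\subseteq C$. Given Plott functions $F,G$ on $C$, a pair $(Y,Z)$ of subsets of $C$ is semi-stable if $Y\cup Z=C$ and $G(Y)\subseteq F(Z)$. -}

module Defs where

open import Data.Bool using (Bool; true; false; _∧_; _∨_; not)
open import Relation.Binary.PropositionalEquality using (_≡_)

-- Subsets of a carrier C, as characteristic (Boolean) functions.
-- (Classically every subset has a characteristic function; using Bool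
-- makes membership decidable, matching the paper's set-theoretic setting.)
Subset : Set → Set
Subset C = C → Bool

module _ {C : Set} where

  _∈_ : C → Subset C → Set
  c ∈ X = X c ≡ true

  _⊆_ : Subset C → Subset C → Set
  X ⊆ Y = ∀ c → c ∈ X → c ∈ Y

  _≐_ : Subset C → Subset C → Set
  X ≐ Y = ∀ c → X c ≡ Y c

  _∪_ : Subset C → Subset C → Subset C
  (X ∪ Y) c = X c ∨ Y c

  _∖_ : Subset C → Subset C → Subset C
  (X ∖ Y) c = X c ∧ not (Y c)

  Whole : Subset C
  Whole c = true

  record ChoiceFunction : Set where
    field
      apply  : Subset C → Subset C
      choose : ∀ X → apply X ⊆ X
      -- well-defined on subsets (subsets are equal iff same elements)
      cong-≐ : ∀ X X′ → X ≐ X′ → apply X ≐ apply X′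

  open ChoiceFunction public

  IsPlott : ChoiceFunction → Set
  IsPlott G = ∀ X Y → apply G (X ∪ Y) ≐ apply G (apply G X ∪ Y)

  SemiStable : ChoiceFunction → ChoiceFunction → Subset C → Subset C → Set
  SemiStable F G Y Z = ((Y ∪ Z) ≐ Whole) × (apply G Y ⊆ apply F Z)
    where open import Data.Product using (_×_)

{-# OPTIONS --safe #-}
module Submission where

-- Covering is preserved because Y′ ∪ Z′ contains Y ∪ F(Z) ∪ (Z ∖ F(Z)) ⊇ Y ∪ Z.
-- For the inclusion, path independence and G(Y) ⊆ F(Z) give
-- G(Y ∪ F(Z)) = G(G(Y) ∪ F(Z)) = G(F(Z)), whose elements lie in Z′ and in F(Z).
-- Since Z′ ⊆ Z, the heritage property of Plott functions
-- (X′ ⊆ X implies F(X) ∩ X′ ⊆ F(X′)) puts them in F(Z′).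

open import Data.Bool using (true; false)
open import Data.Bool.Properties using (∨-zeroʳ)
open import Data.Empty using (⊥-elim)
open import Data.Product using (_×_; _,_; proj₁; proj₂)
open import Data.Sum using (_⊎_; inj₁; inj₂)
open import Relation.Binary.PropositionalEquality using (refl; sym; trans)
open import Relation.Nullary using (¬_)

open import Defs

module _ {C : Set} {X Y : Subset C} where

  ∈-≐ : X ≐ Y → ∀ {c} → c ∈ X → c ∈ Y
  ∈-≐ X≐Y {c} c∈X = trans (sym (X≐Y c)) c∈X

  ⊆⇒∪≐ : X ⊆ Y → (X ∪ Y) ≐ Y
  ⊆⇒∪≐ X⊆Y c with X c | Y c | X⊆Y c
  ... | true  | true  | _   = refl
  ... | true  | false | X→Y = sym (X→Y refl)
  ... | false | _     | _   = refl

  ⊆⇒≐∪∖ : Y ⊆ X → X ≐ (Y ∪ (X ∖ Y))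
  ⊆⇒≐∪∖ Y⊆X c with X c | Y c | Y⊆X c
  ... | true  | true  | _   = refl
  ... | true  | false | _   = refl
  ... | false | true  | Y→X = Y→X refl
  ... | false | false | _   = refl

module _ {C : Set} (X Y : Subset C) where

  ∈-∪⁺ˡ : ∀ {c} → c ∈ X → c ∈ (X ∪ Y)
  ∈-∪⁺ˡ c∈X rewrite c∈X = refl

  ∈-∪⁺ʳ : ∀ {c} → c ∈ Y → c ∈ (X ∪ Y)
  ∈-∪⁺ʳ {c} c∈Y rewrite c∈Y = ∨-zeroʳ (X c)

  ∈-∪⁻ : ∀ {c} → c ∈ (X ∪ Y) → c ∈ X ⊎ c ∈ Y
  ∈-∪⁻ {c} c∈X∪Y with X c
  ... | true  = inj₁ refl
  ... | false = inj₂ c∈X∪Y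

  ∈-∖⁻ : ∀ {c} → c ∈ (X ∖ Y) → c ∈ X × ¬ c ∈ Y
  ∈-∖⁻ {c} c∈X∖Y with X c | Y c
  ... | true | false = refl , λ ()

plott-absorb : {C : Set} (G : ChoiceFunction {C}) {X Y : Subset C} →
               IsPlott G → apply G X ⊆ Y → apply G (X ∪ Y) ≐ apply G Y
plott-absorb G {X} {Y} plott GX⊆Y c =
  trans (plott X Y c) (cong-≐ G _ _ (⊆⇒∪≐ GX⊆Y) c)

plott⇒heritage : {C : Set} (F : ChoiceFunction {C}) {X X′ : Subset C} →
                 IsPlott F → X′ ⊆ X →
                 ∀ {c} → c ∈ apply F X → c ∈ X′ → c ∈ apply F X′
-- Write X = X′ ∪ (X ∖ X′); then F(X) = F(F(X′) ∪ (X ∖ X′)) ⊆ F(X′) ∪ (X ∖ X′).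
plott⇒heritage F {X} {X′} plott X′⊆X {c} c∈FX c∈X′
  with ∈-∪⁻ (apply F X′) (X ∖ X′) (choose F _ c c∈F[FX′∪X∖X′])
  where
  c∈F[FX′∪X∖X′] : c ∈ apply F (apply F X′ ∪ (X ∖ X′))
  c∈F[FX′∪X∖X′] = ∈-≐ (plott X′ (X ∖ X′)) (∈-≐ (cong-≐ F _ _ (⊆⇒≐∪∖ X′⊆X)) c∈FX)
... | inj₁ c∈FX′  = c∈FX′
... | inj₂ c∈X∖X′ = ⊥-elim (proj₂ (∈-∖⁻ X X′ c∈X∖X′) c∈X′)

lemma5 : {C : Set} (F G : ChoiceFunction {C}) → IsPlott F → IsPlott G →
    (Y Z : Subset C) → SemiStable F G Y Z →
    SemiStable F G (Y ∪ apply F Z)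
    ((Z ∖ apply F Z) ∪ apply G (apply F Z))
lemma5 F G plottF plottG Y Z (covers , GY⊆FZ) = covers′ , GY′⊆FZ′
  where
  FZ  = apply F Z
  GFZ = apply G FZ
  Z′  = (Z ∖ FZ) ∪ GFZ

  covers′ : ((Y ∪ FZ) ∪ Z′) ≐ Whole
  covers′ c with ∈-∪⁻ Y Z (covers c)
  ... | inj₁ c∈Y = ∈-∪⁺ˡ (Y ∪ FZ) Z′ (∈-∪⁺ˡ Y FZ c∈Y)
  ... | inj₂ c∈Z with ∈-∪⁻ FZ (Z ∖ FZ) (∈-≐ (⊆⇒≐∪∖ (choose F Z)) c∈Z)
  ...   | inj₁ c∈FZ   = ∈-∪⁺ˡ (Y ∪ FZ) Z′ (∈-∪⁺ʳ Y FZ c∈FZ)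
  ...   | inj₂ c∈Z∖FZ = ∈-∪⁺ʳ (Y ∪ FZ) Z′ (∈-∪⁺ˡ (Z ∖ FZ) GFZ c∈Z∖FZ)

  Z′⊆Z : Z′ ⊆ Z
  Z′⊆Z c c∈Z′ with ∈-∪⁻ (Z ∖ FZ) GFZ c∈Z′
  ... | inj₁ c∈Z∖FZ = proj₁ (∈-∖⁻ Z FZ c∈Z∖FZ)
  ... | inj₂ c∈GFZ  = choose F Z c (choose G FZ c c∈GFZ)

  GY′⊆FZ′ : apply G (Y ∪ FZ) ⊆ apply F Z′
  GY′⊆FZ′ c c∈GY′ =
    plott⇒heritage F plottF Z′⊆Z (choose G FZ c c∈GFZ) (∈-∪⁺ʳ (Z ∖ FZ) GFZ c∈GFZ)
    where
    c∈GFZ : c ∈ GFZ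
    c∈GFZ = ∈-≐ (plott-absorb G plottG GY⊆FZ) c∈GY′
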